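{- For all integers $a,b\geq 2$, the saltire graph ${SA}_{a,b}$ is claw-contractible-free. In particular, for $n\geq 3$ the graph ${SA}_{n,n}$ is claw-contractible-free.
   Context: All graphs are finite and simple. The claw is $K_{1,3}$. A graph $G$ contracts to the claw if there is a subset $S$ of its edges such that contracting the edges of $S$ (identifying endpoints) and replacing multiple edges by single edges yields the claw; $G$ is claw-contractible-free if it does not contract to the claw. For $a,b\geq 2$, the saltire graph ${SA}_{a,b}$ is the graph on vertices $v_1,\dots,v_{a+b}$ with edges $v_iv_{i+1}$ for $1\leq i\leq a+b-1$, together with $v_{a+b}v_1$, $v_1v_{a+1}$ and $v_2v_{a+2}$. -}

module Defs where

open import Data.Nat using (ℕ; zero; suc; _+_; _∸_)
open import Data.Fin using (Fin; toℕ)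
open import Data.Product using (Σ; _×_; ∃; ∃-syntax)
open import Data.Sum using (_⊎_)
open import Relation.Nullary using (¬_)
open import Relation.Binary.PropositionalEquality using (_≡_; _≢_)
open import Relation.Binary.Construct.Closure.ReflexiveTransitive using (Star)
open import Function.Bundles using (_⇔_)

-- A simple graph on vertex set Fin n is given by an adjacency relation
-- (symmetric and irreflexive in all uses below).
Graph : ℕ → Set₁
Graph n = Fin n → Fin n → Set

Sym : ∀ {n} → Graph n → Graph n
Sym R u v = R u v ⊎ R v u

claw : Graph 4
claw i j = (toℕ i ≡ 0 × toℕ j ≢ 0) ⊎ (toℕ j ≡ 0 × toℕ i ≢ 0)

-- Contracting an edge subset S of G: the vertices of the contracted graph are the
-- connected components of the spanning subgraph (V(G), S); two distinct components are
-- adjacent iff some edge of G joins them (loops dropped, multi-edges merged).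
-- "G contracts to the claw": there are an edge subset S and a map f from V(G) onto
-- V(claw) whose fibres are exactly the components of (V(G), S) (so f induces a
-- bijection components ≅ V(claw)) and which turns the contracted graph's adjacency
-- into the claw's adjacency.
ContractsToClaw : ∀ {n} → Graph n → Set₁
ContractsToClaw {n} G =
  Σ (Graph n) λ S →
  ((u v : Fin n) → S u v → G u v) ×
  Σ (Fin n → Fin 4) λ f →
    ((u v : Fin n) → (f u ≡ f v) ⇔ Star (Sym S) u v) ×
    ((i : Fin 4) → ∃[ u ] f u ≡ i) ×
    ((i j : Fin 4) → i ≢ j →
       claw i j ⇔ (∃[ u ] ∃[ v ] (G u v × f u ≡ i × f v ≡ j)))

ClawContractibleFree : ∀ {n} → Graph n → Set₁
ClawContractibleFree G = ¬ ContractsToClaw G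

-- Saltire graph SA_{a,b}: vertex v_k (1 ≤ k ≤ a+b) is represented by Fin index k-1.
-- Directed edge list (then symmetrised):
--   v_i v_{i+1}  (1 ≤ i ≤ a+b-1)   ~ indices  i, i+1
--   v_{a+b} v_1                     ~ indices  a+b-1, 0
--   v_1 v_{a+1}                     ~ indices  0, a
--   v_2 v_{a+2}                     ~ indices  1, a+1
SAEdge : (a b : ℕ) → ℕ → ℕ → Set
SAEdge a b i j =
  (suc i ≡ j) ⊎ ((i ≡ a + b ∸ 1 × j ≡ 0) ⊎ ((i ≡ 0 × j ≡ a) ⊎ (i ≡ 1 × j ≡ suc a)))

SA : (a b : ℕ) → Graph (a + b)
SA a b u v = SAEdge a b (toℕ u) (toℕ v) ⊎ SAEdge a b (toℕ v) (toℕ u)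

-- Colour each vertex of SA_{a,b} by the claw vertex its branch set is contracted to.
-- The three leaf colours must all occur on the Hamiltonian cycle v_1 … v_{a+b}, and
-- along the cycle two differently coloured leaf vertices are always separated by a
-- centre vertex, since leaf branch sets are pairwise non-adjacent.  So the three leaf
-- colours cut the cycle into three arcs, each containing centre vertices.  The centre
-- branch set is connected, so each arc is left by an edge between centre vertices;
-- cycle edges cannot do this, so it is one of the chords v_1 v_{a+1} and v_2 v_{a+2}.
-- Its endpoint inside the arc lies in {v_1, v_2} or in {v_{a+1}, v_{a+2}}, and two of
-- the three arcs would share such a pair of adjacent centre vertices, i.e. coincide.
module Submission where

open import Defs
open import Data.Nat using (ℕ; zero; suc; _+_; _∸_; _≤_; _<_; _%_; pred; z≤n; s≤s⁻¹; _≤?_; _<?_)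
open import Data.Nat.Properties
  using (<-cmp; <-trans; <-≤-trans; <⇒≤; <⇒≱; ≤∧≢⇒<; m≤n⇒m<n∨m≡n; m≤n⇒m≤1+n; m<n⇒m<1+n; n<1+n; n≢0⇒n>0; <⇒≤pred)
  renaming (_≟_ to _≟ℕ_)
open import Data.Fin using (Fin; toℕ; fromℕ<; #_)
open import Data.Fin.Properties using (toℕ<n; toℕ-injective; toℕ-fromℕ<; fromℕ<-toℕ) renaming (_≟_ to _≟ᶠ_)
open import Data.Bool using (if_then_else_)
open import Data.Product using (_×_; _,_; proj₁; proj₂; ∃-syntax)
open import Data.Sum using (_⊎_; inj₁; inj₂; swap; [_,_]′)
import Data.Sum as Sum
open import Data.Empty using (⊥; ⊥-elim)
open import Function using (id; _∘_)
open import Function.Bundles using (Equivalence)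
open import Relation.Nullary using (¬_; yes; no; does)
open import Relation.Nullary.Decidable using (dec-true; dec-false)
open import Relation.Unary using (Pred; Decidable)
open import Relation.Binary using (Rel; tri<; tri≈; tri>)
open import Relation.Binary.PropositionalEquality
  using (_≡_; _≢_; refl; sym; trans; cong; subst; subst₂; ≢-sym; module ≡-Reasoning)
open import Relation.Binary.Construct.Closure.ReflexiveTransitive using (Star; ε; _◅_; _◅◅_)

Star-crossing : ∀ {ℓ r q} {A : Set ℓ} {R : Rel A r} (Q : Pred A q) → Decidable Q →
                ∀ {u v} → Star R u v → Q u → ¬ Q v →
                ∃[ x ] ∃[ y ] (Star R u x × R x y × Q x × ¬ Q y)
Star-crossing Q Q? ε qu ¬qv = ⊥-elim (¬qv qu)
Star-crossing Q Q? {u} (_◅_ {j = w} uw wv) qu ¬qv with Q? w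
... | no ¬qw = u , w , ε , uw , qu , ¬qw
... | yes qw with Star-crossing Q Q? wv qw ¬qv
...   | x , y , wx , xy , qx , ¬qy = x , y , uw ◅ wx , xy , qx , ¬qy

sorted-triple : {R : ℕ → ℕ → ℕ → Set} →
                (∀ {x y z} → R x y z → x ≢ y) →
                (∀ {x y z} → R x y z → R y x z) →
                (∀ {x y z} → R x y z → R x z y) →
                ∀ {x y z} → R x y z → ∃[ p ] ∃[ q ] ∃[ r ] (p < q × q < r × R p q r)
sorted-triple {R} distinct swap₁₂ swap₂₃ {x} {y} {z} rxyz = insert (order₁₂ rxyz)
  where
    order₁₂ : R x y z → ∃[ p ] ∃[ q ] (p < q × R p q z)
    order₁₂ rxyz with <-cmp x y
    ... | tri< x<y _ _ = x , y , x<y , rxyz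
    ... | tri≈ _ x≡y _ = ⊥-elim (distinct rxyz x≡y)
    ... | tri> _ _ y<x = y , x , y<x , swap₁₂ rxyz

    insert : ∃[ p ] ∃[ q ] (p < q × R p q z) → ∃[ p ] ∃[ q ] ∃[ r ] (p < q × q < r × R p q r)
    insert (p , q , p<q , rpqz) with <-cmp q z
    ... | tri< q<z _ _ = p , q , z , p<q , q<z , rpqz
    ... | tri≈ _ q≡z _ = ⊥-elim (distinct (swap₂₃ (swap₁₂ rpqz)) q≡z)
    ... | tri> _ _ z<q with <-cmp p z
    ...   | tri< p<z _ _ = p , z , q , p<z , z<q , swap₂₃ rpqz
    ...   | tri≈ _ p≡z _ = ⊥-elim (distinct (swap₂₃ rpqz) p≡z)
    ...   | tri> _ _ z<p = z , p , q , z<p , p<q , swap₁₂ (swap₂₃ rpqz)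

centre : Fin 4
centre = # 0

claw-centred : ∀ {i j} → claw i j → i ≡ centre ⊎ j ≡ centre
claw-centred (inj₁ (i≡0 , _)) = inj₁ (toℕ-injective i≡0)
claw-centred (inj₂ (j≡0 , _)) = inj₂ (toℕ-injective j≡0)

-- What the argument uses of a claw contraction: colour classes are the branch sets,
-- leaf branch sets are pairwise non-adjacent, and the centre branch set is connected.
record ClawColouring {n} (G : Graph n) : Set₁ where
  field
    colour : Fin n → Fin 4
    onto : ∀ i → ∃[ u ] colour u ≡ i
    leaves-monochromatic : ∀ {u v} → G u v → colour u ≢ centre → colour v ≢ centre →
                           colour u ≡ colour v
    centre-crossing : (Q : Pred (Fin n) _) → Decidable Q →
                      ∀ {u v} → colour u ≡ centre → colour v ≡ centre → Q u → ¬ Q v →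
                      ∃[ x ] ∃[ y ] (Sym G x y × colour x ≡ centre × colour y ≡ centre × Q x × ¬ Q y)

contraction⇒ClawColouring : ∀ {n} {G : Graph n} → ContractsToClaw G → ClawColouring G
contraction⇒ClawColouring {G = G} (S , S⊆G , f , fibres , onto , adjacency) = record
  { colour = f
  ; onto = onto
  ; leaves-monochromatic = leaves-monochromatic
  ; centre-crossing = centre-crossing
  }
  where
    leaves-monochromatic : ∀ {u v} → G u v → f u ≢ centre → f v ≢ centre → f u ≡ f v
    leaves-monochromatic {u} {v} uv fu fv with f u ≟ᶠ f v
    ... | yes fu≡fv = fu≡fv
    ... | no fu≢fv with claw-centred (Equivalence.from (adjacency _ _ fu≢fv) (u , v , uv , refl , refl))
    ...   | inj₁ fu≡centre = ⊥-elim (fu fu≡centre)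
    ...   | inj₂ fv≡centre = ⊥-elim (fv fv≡centre)

    centre-crossing : (Q : Pred _ _) → Decidable Q → ∀ {u v} → f u ≡ centre → f v ≡ centre →
                      Q u → ¬ Q v →
                      ∃[ x ] ∃[ y ] (Sym G x y × f x ≡ centre × f y ≡ centre × Q x × ¬ Q y)
    centre-crossing Q Q? {u} {v} fu fv qu ¬qv
      with Star-crossing Q Q? (Equivalence.to (fibres u v) (trans fu (sym fv))) qu ¬qv
    ... | x , y , ux , xy , qx , ¬qy =
      x , y , Sum.map (S⊆G x y) (S⊆G y x) xy ,
      in-centre ux , in-centre (ux ◅◅ (xy ◅ ε)) , qx , ¬qy
      where
        in-centre : ∀ {w} → Star (Sym S) u w → f w ≡ centre
        in-centre uw = trans (sym (Equivalence.from (fibres u _) uw)) fu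

SAAdj : ℕ → ℕ → ℕ → ℕ → Set
SAAdj a b i j = SAEdge a b i j ⊎ SAEdge a b j i

Near : ℕ → ℕ → Set
Near c x = x ≡ c ⊎ x ≡ suc c

ChordEnd : ℕ → ℕ → Set
ChordEnd a x = Near 0 x ⊎ Near a x

passed : ℕ → ℕ → ℕ
passed p n = if does (p ≤? n) then 1 else 0

passed-≤ : ∀ {p n} → p ≤ n → passed p n ≡ 1
passed-≤ {p} {n} p≤n rewrite dec-true (p ≤? n) p≤n = refl

passed-≰ : ∀ {p n} → ¬ p ≤ n → passed p n ≡ 0
passed-≰ {p} {n} p≰n rewrite dec-false (p ≤? n) p≰n = refl

passed-suc : ∀ {p n} → suc n ≢ p → passed p (suc n) ≡ passed p n
passed-suc {p} {n} 1+n≢p with p ≤? n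
... | yes p≤n = trans (passed-≤ (m≤n⇒m≤1+n p≤n)) (sym (passed-≤ p≤n))
... | no p≰n = trans (passed-≰ p≰1+n) (sym (passed-≰ p≰n))
  where
    p≰1+n : ¬ p ≤ suc n
    p≰1+n p≤1+n = p≰n (s≤s⁻¹ (≤∧≢⇒< p≤1+n (≢-sym 1+n≢p)))

pred<self : ∀ {m n} → m < n → pred n < n
pred<self {n = suc n} _ = n<1+n n

module NoClawColouring {a b : ℕ} (κ : ClawColouring (SA a b)) where
  open ClawColouring κ

  -- Beyond the last vertex the colour is junk, chosen to be the centre so that a leaf
  -- colour certifies that n is a vertex.
  col : ℕ → Fin 4
  col n with n <? a + b
  ... | yes n<N = colour (fromℕ< n<N)
  ... | no _ = centre

  col-fromℕ< : ∀ {n} (n<N : n < a + b) → col n ≡ colour (fromℕ< n<N)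
  col-fromℕ< {n} n<N with n <? a + b
  ... | yes _ = refl
  ... | no n≮N = ⊥-elim (n≮N n<N)

  col-toℕ : ∀ u → col (toℕ u) ≡ colour u
  col-toℕ u = trans (col-fromℕ< (toℕ<n u)) (cong colour (fromℕ<-toℕ u (toℕ<n u)))

  leaf⇒vertex : ∀ {n} → col n ≢ centre → n < a + b
  leaf⇒vertex {n} leaf with n <? a + b
  ... | yes n<N = n<N
  ... | no _ = ⊥-elim (leaf refl)

  leaves-monochromaticℕ : ∀ {i j} → SAAdj a b i j → col i ≢ centre → col j ≢ centre →
                          col i ≡ col j
  leaves-monochromaticℕ {i} {j} ij ci cj = begin
    col i                   ≡⟨ col-fromℕ< i<N ⟩
    colour (fromℕ< i<N)     ≡⟨ leaves-monochromatic uv (ci ∘ trans (col-fromℕ< i<N))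
                                                        (cj ∘ trans (col-fromℕ< j<N)) ⟩
    colour (fromℕ< j<N)     ≡⟨ col-fromℕ< j<N ⟨
    col j                   ∎
    where
      open ≡-Reasoning
      i<N = leaf⇒vertex ci
      j<N = leaf⇒vertex cj
      uv : SA a b (fromℕ< i<N) (fromℕ< j<N)
      uv = subst₂ (SAAdj a b) (sym (toℕ-fromℕ< i<N)) (sym (toℕ-fromℕ< j<N)) ij

  centre-crossingℕ : (P : Pred ℕ _) → Decidable P →
                     ∀ {i j} → i < a + b → j < a + b → col i ≡ centre → col j ≡ centre → P i → ¬ P j →
                     ∃[ x ] ∃[ y ] (SAAdj a b x y × col x ≡ centre × col y ≡ centre × P x × ¬ P y)
  centre-crossingℕ P P? i<N j<N ci cj pi ¬pj
    with centre-crossing (P ∘ toℕ) (P? ∘ toℕ)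
           (trans (sym (col-fromℕ< i<N)) ci) (trans (sym (col-fromℕ< j<N)) cj)
           (subst P (sym (toℕ-fromℕ< i<N)) pi) (¬pj ∘ subst P (toℕ-fromℕ< j<N))
  ... | x , y , xy , cx , cy , px , ¬py =
    toℕ x , toℕ y , [ id , swap ]′ xy , trans (col-toℕ x) cx , trans (col-toℕ y) cy , px , ¬py

  centre≢leaf : ∀ {m n} → col m ≡ centre → col n ≢ centre → m ≢ n
  centre≢leaf cm cn refl = cn cm

  centre-between : ∀ {i j} → i ≤ j → col i ≢ centre → col j ≢ centre → col i ≢ col j →
                   ∃[ w ] (i < w × w < j × col w ≡ centre)
  centre-between {j = zero} z≤n ci cj ci≢cj = ⊥-elim (ci≢cj refl)
  centre-between {i} {suc j} i≤1+j ci c1+j ci≢c1+j with m≤n⇒m<n∨m≡n i≤1+j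
  ... | inj₂ refl = ⊥-elim (ci≢c1+j refl)
  ... | inj₁ i<1+j with col j ≟ᶠ centre
  ...   | yes cj = j , ≤∧≢⇒< (s≤s⁻¹ i<1+j) (≢-sym (centre≢leaf cj ci)) , n<1+n j , cj
  ...   | no cj with centre-between (s≤s⁻¹ i<1+j) ci cj
                       (λ ci≡cj → ci≢c1+j (trans ci≡cj (leaves-monochromaticℕ (inj₁ (inj₁ refl)) cj c1+j)))
  ...     | w , i<w , w<j , cw = w , i<w , m<n⇒m<1+n w<j , cw

  record Rainbow (x y z : ℕ) : Set where
    field
      leaf₁ : col x ≢ centre
      leaf₂ : col y ≢ centre
      leaf₃ : col z ≢ centre
      distinct₁₂ : col x ≢ col y
      distinct₂₃ : col y ≢ col z
      distinct₁₃ : col x ≢ col z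

  Rainbow-distinct : ∀ {x y z} → Rainbow x y z → x ≢ y
  Rainbow-distinct ρ x≡y = Rainbow.distinct₁₂ ρ (cong col x≡y)

  Rainbow-swap₁₂ : ∀ {x y z} → Rainbow x y z → Rainbow y x z
  Rainbow-swap₁₂ ρ = record
    { leaf₁ = leaf₂ ; leaf₂ = leaf₁ ; leaf₃ = leaf₃
    ; distinct₁₂ = ≢-sym distinct₁₂ ; distinct₂₃ = distinct₁₃ ; distinct₁₃ = distinct₂₃ }
    where open Rainbow ρ

  Rainbow-swap₂₃ : ∀ {x y z} → Rainbow x y z → Rainbow x z y
  Rainbow-swap₂₃ ρ = record
    { leaf₁ = leaf₁ ; leaf₂ = leaf₃ ; leaf₃ = leaf₂
    ; distinct₁₂ = distinct₁₃ ; distinct₂₃ = ≢-sym distinct₂₃ ; distinct₁₃ = distinct₁₂ }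
    where open Rainbow ρ

  module Arcs {p q r : ℕ} (p<q : p < q) (q<r : q < r) (ρ : Rainbow p q r) where
    open Rainbow ρ

    r<N : r < a + b
    r<N = leaf⇒vertex leaf₃

    p<N : p < a + b
    p<N = leaf⇒vertex leaf₁

    centre₀⇒0<p : col 0 ≡ centre → 0 < p
    centre₀⇒0<p c0 = n≢0⇒n>0 (≢-sym (centre≢leaf c0 leaf₁))

    last : ℕ
    last = a + b ∸ 1

    -- The number of p, q, r at or before n, counted cyclically: arc 1 is [p, q),
    -- arc 2 is [q, r), and arc 0 is the rest of the cycle.
    arc : ℕ → ℕ
    arc n = (passed p n + passed q n + passed r n) % 3

    arc-of : ∀ {n i j k} → passed p n ≡ i → passed q n ≡ j → passed r n ≡ k →
             arc n ≡ (i + j + k) % 3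
    arc-of refl refl refl = refl

    arc-before-p : ∀ {n} → n < p → arc n ≡ 0
    arc-before-p n<p =
      arc-of (passed-≰ (<⇒≱ n<p)) (passed-≰ (<⇒≱ (<-trans n<p p<q)))
             (passed-≰ (<⇒≱ (<-trans n<p (<-trans p<q q<r))))

    arc-p-q : ∀ {n} → p ≤ n → n < q → arc n ≡ 1
    arc-p-q p≤n n<q = arc-of (passed-≤ p≤n) (passed-≰ (<⇒≱ n<q)) (passed-≰ (<⇒≱ (<-trans n<q q<r)))

    arc-q-r : ∀ {n} → q ≤ n → n < r → arc n ≡ 2
    arc-q-r q≤n n<r = arc-of (passed-≤ (<⇒≤ (<-≤-trans p<q q≤n))) (passed-≤ q≤n) (passed-≰ (<⇒≱ n<r))

    arc-from-r : ∀ {n} → r ≤ n → arc n ≡ 0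
    arc-from-r r≤n =
      arc-of (passed-≤ (<⇒≤ (<-trans p<q q<n))) (passed-≤ (<⇒≤ q<n)) (passed-≤ r≤n)
      where
        q<n = <-≤-trans q<r r≤n

    arc-step : ∀ n → col (suc n) ≡ centre → arc (suc n) ≡ arc n
    arc-step n c =
      arc-of (passed-suc (centre≢leaf c leaf₁)) (passed-suc (centre≢leaf c leaf₂))
             (passed-suc (centre≢leaf c leaf₃))

    arc-wrap : col 0 ≡ centre → arc last ≡ arc 0
    arc-wrap c0 = trans (arc-from-r (<⇒≤pred r<N)) (sym (arc-before-p (centre₀⇒0<p c0)))

    ArcCentre : ℕ → Set
    ArcCentre k = ∃[ w ] (w < a + b × col w ≡ centre × arc w ≡ k)

    centre-p-q : ArcCentre 1
    centre-p-q with centre-between (<⇒≤ p<q) leaf₁ leaf₂ distinct₁₂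
    ... | w , p<w , w<q , cw = w , <-trans w<q (leaf⇒vertex leaf₂) , cw , arc-p-q (<⇒≤ p<w) w<q

    centre-q-r : ArcCentre 2
    centre-q-r with centre-between (<⇒≤ q<r) leaf₂ leaf₃ distinct₂₃
    ... | w , q<w , w<r , cw = w , <-trans w<r r<N , cw , arc-q-r (<⇒≤ q<w) w<r

    -- Either v_1 is a centre vertex, or a centre vertex separates v_1 from p, or else
    -- v_1 has the colour of p and one separates r from v_{a+b} (joined to v_1).
    centre-wrap : ArcCentre 0
    centre-wrap with col 0 ≟ᶠ centre
    ... | yes c0 = 0 , <-trans (centre₀⇒0<p c0) p<N , c0 , arc-before-p (centre₀⇒0<p c0)
    ... | no c0 with col 0 ≟ᶠ col p
    ...   | no c0≢cp with centre-between z≤n c0 leaf₁ c0≢cp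
    ...     | w , _ , w<p , cw = w , <-trans w<p p<N , cw , arc-before-p w<p
    centre-wrap | no c0 | yes c0≡cp with col last ≟ᶠ centre
    ...   | yes cl = last , pred<self r<N , cl , arc-from-r (<⇒≤pred r<N)
    ...   | no cl with centre-between (<⇒≤pred r<N) leaf₃ cl
                         (λ cr≡cl → distinct₁₃ (trans (sym c0≡cp)
                            (trans (leaves-monochromaticℕ (inj₂ (inj₂ (inj₁ (refl , refl)))) c0 cl) (sym cr≡cl))))
    ...     | w , r<w , w<last , cw = w , <-trans w<last (pred<self r<N) , cw , arc-from-r (<⇒≤ r<w)

    edge-leaving-arc : ∀ {x y} → SAAdj a b x y → col x ≡ centre → col y ≡ centre → arc x ≢ arc y →
                       ChordEnd a x
    edge-leaving-arc {x} (inj₁ (inj₁ refl)) cx cy ax≢ay = ⊥-elim (ax≢ay (sym (arc-step x cy)))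
    edge-leaving-arc (inj₁ (inj₂ (inj₁ (refl , refl)))) cx cy ax≢ay = ⊥-elim (ax≢ay (arc-wrap cy))
    edge-leaving-arc (inj₁ (inj₂ (inj₂ (inj₁ (refl , refl))))) cx cy ax≢ay = inj₁ (inj₁ refl)
    edge-leaving-arc (inj₁ (inj₂ (inj₂ (inj₂ (refl , refl))))) cx cy ax≢ay = inj₁ (inj₂ refl)
    edge-leaving-arc {y = y} (inj₂ (inj₁ refl)) cx cy ax≢ay = ⊥-elim (ax≢ay (arc-step y cx))
    edge-leaving-arc (inj₂ (inj₂ (inj₁ (refl , refl)))) cx cy ax≢ay = ⊥-elim (ax≢ay (sym (arc-wrap cx)))
    edge-leaving-arc (inj₂ (inj₂ (inj₂ (inj₁ (refl , refl))))) cx cy ax≢ay = inj₂ (inj₁ refl)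
    edge-leaving-arc (inj₂ (inj₂ (inj₂ (inj₂ (refl , refl))))) cx cy ax≢ay = inj₂ (inj₂ refl)

    ArcExit : ℕ → Set
    ArcExit k = ∃[ x ] (col x ≡ centre × ChordEnd a x × arc x ≡ k)

    arc-exit : ∀ {k m} → ArcCentre k → ArcCentre m → k ≢ m → ArcExit k
    arc-exit {k} (i , i<N , ci , ai) (j , j<N , cj , aj) k≢m
      with centre-crossingℕ (λ n → arc n ≡ k) (λ n → arc n ≟ℕ k) i<N j<N ci cj ai (λ aj≡k → k≢m (trans (sym aj≡k) aj))
    ... | x , y , xy , cx , cy , ax , ¬ay = x , cx , edge-leaving-arc xy cx cy (λ ax≡ay → ¬ay (trans (sym ax≡ay) ax)) , ax

    near-same-arc : ∀ {c x y} → Near c x → Near c y → col x ≡ centre → col y ≡ centre → arc x ≡ arc y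
    near-same-arc (inj₁ refl) (inj₁ refl) cx cy = refl
    near-same-arc {c} (inj₁ refl) (inj₂ refl) cx cy = sym (arc-step c cy)
    near-same-arc {c} (inj₂ refl) (inj₁ refl) cx cy = arc-step c cx
    near-same-arc (inj₂ refl) (inj₂ refl) cx cy = refl

    exits-share-arc : ∀ {k l m} → ArcExit k → ArcExit l → ArcExit m → k ≡ l ⊎ l ≡ m ⊎ k ≡ m
    exits-share-arc {k} {l} {m} (x , cx , ex , ax) (y , cy , ey , ay) (z , cz , ez , az) = share ex ey ez
      where
        same : ∀ {c u v k′ l′} → Near c u → Near c v → col u ≡ centre → col v ≡ centre → arc u ≡ k′ → arc v ≡ l′ → k′ ≡ l′
        same nu nv cu cv au av = trans (sym au) (trans (near-same-arc nu nv cu cv) av)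

        share : ChordEnd a x → ChordEnd a y → ChordEnd a z → k ≡ l ⊎ l ≡ m ⊎ k ≡ m
        share (inj₁ nx) (inj₁ ny) _ = inj₁ (same nx ny cx cy ax ay)
        share (inj₂ nx) (inj₂ ny) _ = inj₁ (same nx ny cx cy ax ay)
        share (inj₁ nx) (inj₂ ny) (inj₁ nz) = inj₂ (inj₂ (same nx nz cx cz ax az))
        share (inj₁ nx) (inj₂ ny) (inj₂ nz) = inj₂ (inj₁ (same ny nz cy cz ay az))
        share (inj₂ nx) (inj₁ ny) (inj₁ nz) = inj₂ (inj₁ (same ny nz cy cz ay az))
        share (inj₂ nx) (inj₁ ny) (inj₂ nz) = inj₂ (inj₂ (same nx nz cx cz ax az))

    impossible : ⊥
    impossible with exits-share-arc (arc-exit centre-wrap centre-p-q (λ ()))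
                                    (arc-exit centre-p-q centre-wrap (λ ()))
                                    (arc-exit centre-q-r centre-wrap (λ ()))
    ... | inj₁ ()
    ... | inj₂ (inj₁ ())
    ... | inj₂ (inj₂ ())

  leaf-vertex : Fin 4 → ℕ
  leaf-vertex i = toℕ (proj₁ (onto i))

  col-leaf-vertex : ∀ i → col (leaf-vertex i) ≡ i
  col-leaf-vertex i = trans (col-toℕ (proj₁ (onto i))) (proj₂ (onto i))

  rainbow : Rainbow (leaf-vertex (# 1)) (leaf-vertex (# 2)) (leaf-vertex (# 3))
  rainbow = record
    { leaf₁ = leaf (# 1) (λ ()) ; leaf₂ = leaf (# 2) (λ ()) ; leaf₃ = leaf (# 3) (λ ())
    ; distinct₁₂ = apart (# 1) (# 2) (λ ()) ; distinct₂₃ = apart (# 2) (# 3) (λ ())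
    ; distinct₁₃ = apart (# 1) (# 3) (λ ()) }
    where
      leaf : ∀ i → i ≢ centre → col (leaf-vertex i) ≢ centre
      leaf i = subst (_≢ centre) (sym (col-leaf-vertex i))

      apart : ∀ i j → i ≢ j → col (leaf-vertex i) ≢ col (leaf-vertex j)
      apart i j = subst₂ _≢_ (sym (col-leaf-vertex i)) (sym (col-leaf-vertex j))

  impossible : ⊥
  impossible with sorted-triple Rainbow-distinct Rainbow-swap₁₂ Rainbow-swap₂₃ rainbow
  ... | p , q , r , p<q , q<r , ρ = Arcs.impossible p<q q<r ρ

lemma3p1 : (a b : ℕ) → 2 ≤ a → 2 ≤ b → ClawContractibleFree (SA a b)
lemma3p1 a b _ _ = NoClawColouring.impossible ∘ contraction⇒ClawColouring
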